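{- Fix $d\geq2$, $X=\mathbb{N}^d$, and $2\leq r\leq d$. Call $x\in X$ $r$-tight if $\delta^r(x)$ is the lowest (with respect to height) point of $\{i(\delta^r(x)),\dots,i(\delta^d(x))\}\times\mathbb{N}$ that is higher than $\delta^{r-1}(x)$. Then for every $1\leq j\leq r-1$, if $x$ is $r$-tight then $g_j(x)$ is $r$-tight.
   Context: For $x=(n_1,\dots,n_d)\in X$, $\Delta(x)=\{(1,n_1),\dots,(d,n_d)\}\subseteq[d]\times\mathbb{N}$ (conversely $d$ points with distinct first coordinates determine an element of $X$). For $\delta=(i,n)$, seat $i(\delta)=i$, height $h(\delta)=n+i/d$; points ordered by height ($\delta_1\prec\delta_2$ iff $h(\delta_1)<h(\delta_2)$, "higher" means larger height); $\delta+s/d$ is the point of height $h(\delta)+s/d$. $\Delta(x)=\{\delta^1(x)\prec\cdots\prec\delta^d(x)\}$. Operator $g_j:X\to X$ ($j\in[d]$): $g_j(x)=x'$ with $\delta^k(x')=\delta^k(x)$ for $k<j$ and $\delta^k(x')=\delta^k(x)+s_k/d$ for $k\geq j$, $s_k$ the smallest positive integer with the seat of $\delta^k(x)+s_k/d$ in $\{i(\delta^j(x)),\dots,i(\delta^d(x))\}$. -}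

module Defs where

open import Data.Nat using (ℕ; zero; suc; _+_; _*_; _≤_; _<_; _<?_)
open import Data.Fin using (Fin; toℕ)
open import Data.List using (List; length; filter; allFin)
open import Data.Product using (_×_; _,_; proj₁; proj₂; ∃)
open import Relation.Binary.PropositionalEquality using (_≡_)
open import Relation.Nullary using (¬_)

X : ℕ → Set
X d = Fin d → ℕ

-- A point δ = (i , n) ∈ [d] × ℕ ; seat Fin d stands for i = toℕ + 1.
Point : ℕ → Set
Point d = Fin d × ℕ

seat : ∀ {d} → Point d → Fin d
seat = proj₁

-- key p = d · h(p) = n·d + i   (an injective, order-preserving encoding of the height)
key : ∀ {d} → Point d → ℕ
key {d} (i , n) = n * d + suc (toℕ i)

_≺_ : ∀ {d} → Point d → Point d → Set
p ≺ q = key p < key q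

InΔ : ∀ {d} → X d → Point d → Set
InΔ x (i , n) = n ≡ x i

countBelow : ∀ {d} → X d → Point d → ℕ
countBelow {d} x p = length (filter (λ i → key (i , x i) <? key p) (allFin d))

-- Del x k p :  δ^k(x) = p   (k is 1-indexed: p ∈ Δ(x) and exactly k-1 points of Δ(x) lie below p)
Del : ∀ {d} → X d → ℕ → Point d → Set
Del x k p = InΔ x p × suc (countBelow x p) ≡ k

-- the seat i belongs to {i(δ^j(x)), …, i(δ^d(x))}
InSeats : ∀ {d} → X d → ℕ → Fin d → Set
InSeats x j i = j ≤ suc (countBelow x (i , x i))

-- q is the lowest point of S × ℕ strictly higher than p, i.e. q = p + s/d with s the smallest
-- positive integer such that the seat of p + s/d lies in S
NextIn : ∀ {d} → (Fin d → Set) → Point d → Point d → Set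
NextIn S p q = (p ≺ q) × S (seat q) × (∀ q' → p ≺ q' → q' ≺ q → ¬ S (seat q'))

-- IsG j x x' :  x' = g_j(x)  (graph of the operator g_j, literally as defined)
IsG : ∀ {d} → ℕ → X d → X d → Set
IsG {d} j x x' = ∀ k p → 1 ≤ k → k ≤ d → Del x k p →
  (k < j → Del x' k p) × (j ≤ k → ∃ λ q → NextIn (InSeats x j) p q × Del x' k q)

Tight : ∀ {d} → ℕ → X d → Set
Tight r x = ∀ p q → Del x r p → Del x (r Data.Nat.∸ 1) q → NextIn (InSeats x r) q p

-- Write A = δ^{r-1}(x), B = δ^r(x) and A', B' for their images under g_j. Suppose a point Q
-- with A' ≺ Q ≺ B' sat on a seat of {i(δ^r(x')),…,i(δ^d(x'))}. That seat carries δ^k(x') = R for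
-- some k ≥ r, and R is where g_j moves C = δ^k(x) ≽ B. Since R's seat is among the seats g_j
-- moves to, Q cannot lie strictly between B and B', so Q ≼ B ≼ C ≺ R and R = Q + t rows.
-- Lifting A' by t rows gives a point below R on an admissible seat, hence not above C; so
-- Q₀ = C − t rows satisfies A ≺ A' ≼ Q₀ ≺ Q ≼ B. But Q₀ sits on the seat of C, one of
-- i(δ^r(x)),…,i(δ^d(x)), contradicting the r-tightness of x.
module Submission where

open import Defs
open import Data.Nat using (ℕ; suc; _+_; _*_; _∸_; _≤_; _<_; z≤n; s≤s; z<s; s≤s⁻¹)
open import Data.Nat.Properties hiding (_≟_)
open import Data.Fin using (Fin; toℕ; fromℕ<; punchOut; _≟_)
open import Data.Fin.Properties
  using (toℕ<n; toℕ-injective; toℕ-fromℕ<; fromℕ<-injective; any?; punchOut-injective;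
         <⇒notInjective)
open import Data.List using ([]; _∷_; length; filter; allFin)
open import Data.List.Properties using (filter-notAll; length-tabulate)
open import Data.List.Relation.Unary.Any using (here; there)
import Data.List.Relation.Unary.Any as Any
open import Data.List.Membership.Propositional using (_∈_)
open import Data.List.Membership.Propositional.Properties using (∈-allFin)
open import Data.Product using (_×_; _,_; proj₁; proj₂; ∃)
open import Data.Sum using (inj₁; inj₂)
open import Data.Empty using (⊥-elim)
open import Function using (id)
open import Function.Definitions using (Injective)
open import Relation.Nullary using (¬_; yes; no; contradiction)
open import Relation.Unary using (Pred; Decidable)
open import Relation.Binary.PropositionalEquality
open import Relation.Binary using (tri<; tri≈; tri>)

module _ {a p q} {A : Set a} {P : Pred A p} {Q : Pred A q} (P? : Decidable P) (Q? : Decidable Q)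
         (P⇒Q : ∀ {y} → P y → Q y) where

  length-filter-mono : ∀ xs → length (filter P? xs) ≤ length (filter Q? xs)
  length-filter-mono [] = z≤n
  length-filter-mono (y ∷ ys) with P? y | Q? y
  ... | yes _  | yes _  = s≤s (length-filter-mono ys)
  ... | yes py | no ¬qy = contradiction (P⇒Q py) ¬qy
  ... | no _   | yes _  = m≤n⇒m≤1+n (length-filter-mono ys)
  ... | no _   | no _   = length-filter-mono ys

  length-filter-mono-< : ∀ {y} xs → y ∈ xs → Q y → ¬ P y →
                         length (filter P? xs) < length (filter Q? xs)
  length-filter-mono-< (y ∷ ys) (here refl) qy ¬py with P? y | Q? y
  ... | yes py | _      = contradiction py ¬py
  ... | no _   | yes _  = s≤s (length-filter-mono ys)
  ... | no _   | no ¬qy = contradiction qy ¬qy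
  length-filter-mono-< (z ∷ zs) (there y∈zs) qy ¬py with P? z | Q? z
  ... | yes _  | yes _  = s≤s (length-filter-mono-< zs y∈zs qy ¬py)
  ... | yes pz | no ¬qz = contradiction (P⇒Q pz) ¬qz
  ... | no _   | yes _  = m<n⇒m<1+n (length-filter-mono-< zs y∈zs qy ¬py)
  ... | no _   | no _   = length-filter-mono-< zs y∈zs qy ¬py

injective⇒surjective : ∀ {n} {f : Fin n → Fin n} → Injective _≡_ _≡_ f → ∀ c → ∃ λ i → f i ≡ c
injective⇒surjective {suc n} {f} f-injective c with any? (λ i → f i ≟ c)
... | yes hit = hit
... | no miss = ⊥-elim (<⇒notInjective (n<1+n n) punchOut-f-injective)
  where
    c≢f : ∀ i → c ≢ f i
    c≢f i c≡fi = miss (i , sym c≡fi)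
    punchOut-f-injective : Injective _≡_ _≡_ (λ i → punchOut (c≢f i))
    punchOut-f-injective eq = f-injective (punchOut-injective (c≢f _) (c≢f _) eq)

module _ {d : ℕ} where

  infixl 25 _↑_
  _↑_ : Point d → ℕ → Point d
  p ↑ t = seat p , proj₂ p + t

  key-↑ : ∀ (p : Point d) t → key (p ↑ t) ≡ key p + t * d
  key-↑ (i , n) t = begin
    (n + t) * d + s      ≡⟨ cong (_+ s) (*-distribʳ-+ d n t) ⟩
    n * d + t * d + s    ≡⟨ +-assoc (n * d) (t * d) s ⟩
    n * d + (t * d + s)  ≡⟨ cong (n * d +_) (+-comm (t * d) s) ⟩
    n * d + (s + t * d)  ≡⟨ +-assoc (n * d) s (t * d) ⟨
    n * d + s + t * d    ∎
    where
      open ≡-Reasoning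
      s = suc (toℕ i)

  ↑-mono-≺ : ∀ {p q : Point d} t → p ≺ q → p ↑ t ≺ q ↑ t
  ↑-mono-≺ {p} {q} t p≺q =
    subst₂ _<_ (sym (key-↑ p t)) (sym (key-↑ q t)) (+-monoˡ-< (t * d) p≺q)

  ↑-cancel-≺ : ∀ {p q : Point d} t → p ↑ t ≺ q ↑ t → p ≺ q
  ↑-cancel-≺ {p} {q} t lt =
    +-cancelʳ-< (t * d) (key p) (key q) (subst₂ _<_ (key-↑ p t) (key-↑ q t) lt)

  ↑-cancel-≤ : ∀ {p q : Point d} t → key (p ↑ t) ≤ key (q ↑ t) → key p ≤ key q
  ↑-cancel-≤ {p} {q} t le =
    +-cancelʳ-≤ (t * d) (key p) (key q) (subst₂ _≤_ (key-↑ p t) (key-↑ q t) le)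

  key-positive : ∀ (p : Point d) → 0 < key p
  key-positive (i , n) = <-≤-trans z<s (m≤n+m (suc (toℕ i)) (n * d))

  key-≤-row : ∀ (i : Fin d) {m n} → m < n → key (i , m) ≤ n * d
  key-≤-row i {m} {n} m<n = begin
    m * d + suc (toℕ i) ≤⟨ +-monoʳ-≤ (m * d) (toℕ<n i) ⟩
    m * d + d           ≡⟨ +-comm (m * d) d ⟩
    suc m * d           ≤⟨ *-monoˡ-≤ d m<n ⟩
    n * d               ∎
    where open ≤-Reasoning

  row-<⇒≺ : ∀ (i j : Fin d) {m n} → m < n → (i , m) ≺ (j , n)
  row-<⇒≺ i j {n = n} m<n = ≤-<-trans (key-≤-row i m<n) (m<m+n (n * d) z<s)

  key-injective : ∀ {p q : Point d} → key p ≡ key q → p ≡ q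
  key-injective {i , m} {j , n} eq with <-cmp m n
  ... | tri< m<n _ _ = contradiction eq (<⇒≢ (row-<⇒≺ i j m<n))
  ... | tri> _ _ n<m = contradiction (sym eq) (<⇒≢ (row-<⇒≺ j i n<m))
  ... | tri≈ _ refl _ = cong (_, m) (toℕ-injective (suc-injective (+-cancelˡ-≡ (m * d) _ _ eq)))

  ≺-same-seat⇒↑ : ∀ {p q : Point d} → seat p ≡ seat q → p ≺ q → ∃ λ t → p ↑ t ≡ q
  ≺-same-seat⇒↑ {i , m} {.i , n} refl lt = n ∸ m , cong (i ,_) (m+[n∸m]≡n m≤n)
    where
      m≤n : m ≤ n
      m≤n = ≮⇒≥ λ n<m → <⇒≱ lt (+-monoˡ-≤ (suc (toℕ i)) (*-monoˡ-≤ d (<⇒≤ n<m)))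

  ↑-≤⇒lowerable : ∀ (p q : Point d) t → key (p ↑ t) ≤ key q → ∃ λ q₀ → q₀ ↑ t ≡ q
  ↑-≤⇒lowerable p (i , n) t le = (i , n ∸ t) , cong (i ,_) (m∸n+n≡m t≤n)
    where
      t≤n : t ≤ n
      t≤n = ≮⇒≥ λ n<t → <⇒≱ (≤-<-trans (key-≤-row i n<t) (m<n+m (t * d) (key-positive p)))
                             (subst (_≤ key (i , n)) (key-↑ p t) le)

  NextIn-gap : ∀ {S : Fin d → Set} {p q z : Point d} →
               NextIn S p q → S (seat z) → z ≺ q → key z ≤ key p
  NextIn-gap {z = z} (_ , _ , gap) Sz z≺q = ≮⇒≥ λ p≺z → gap z p≺z z≺q Sz

  -- The lift a ↑ t is admissible and below r = q ↑ t, so it is not above c; hence c can be lowered.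
  NextIn-lower : ∀ {S : Fin d → Set} {c r a q : Point d} {t} → NextIn S c r → q ↑ t ≡ r →
                 S (seat a) → a ≺ q → ∃ λ q₀ → q₀ ↑ t ≡ c × key a ≤ key q₀ × q₀ ≺ q
  NextIn-lower {c = c} {a = a} {q} {t} next@(c≺r , _) refl Sa a≺q
    with a↑t≼c ← NextIn-gap {p = c} {q ↑ t} {a ↑ t} next Sa (↑-mono-≺ {a} {q} t a≺q)
    with q₀ , refl ← ↑-≤⇒lowerable a c t a↑t≼c
    = q₀ , refl , ↑-cancel-≤ {a} {q₀} t a↑t≼c , ↑-cancel-≺ {q₀} {q} t c≺r

module Ranks {d : ℕ} (x : X d) where

  rank : Fin d → ℕ
  rank i = countBelow x (i , x i)

  countBelow-mono : ∀ {p q : Point d} → key p ≤ key q → countBelow x p ≤ countBelow x q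
  countBelow-mono {p} {q} p≼q =
    length-filter-mono (λ i → key (i , x i) <? key p) (λ i → key (i , x i) <? key q)
                       (λ lt → <-≤-trans lt p≼q) (allFin d)

  rank<countBelow : ∀ {i} {q : Point d} → (i , x i) ≺ q → rank i < countBelow x q
  rank<countBelow {i} {q} lt =
    length-filter-mono-< (λ k → key (k , x k) <? key (i , x i)) (λ k → key (k , x k) <? key q)
                         (λ lt' → <-trans lt' lt) (allFin d) (∈-allFin i) lt (<-irrefl refl)

  rank<d : ∀ i → rank i < d
  rank<d i = <-≤-trans (filter-notAll (λ k → key (k , x k) <? key (i , x i)) (allFin d)
                                      (Any.map (λ { refl → <-irrefl refl }) (∈-allFin i)))
                       (≤-reflexive (length-tabulate id))

  rank-injective : ∀ {i j} → rank i ≡ rank j → i ≡ j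
  rank-injective {i} {j} eq with <-cmp (key (i , x i)) (key (j , x j))
  ... | tri< lt _ _  = contradiction eq (<⇒≢ (rank<countBelow {q = j , x j} lt))
  ... | tri≈ _ eq′ _ = cong proj₁ (key-injective {p = i , x i} {j , x j} eq′)
  ... | tri> _ _ gt  = contradiction (sym eq) (<⇒≢ (rank<countBelow {q = i , x i} gt))

  Del-rank : ∀ i → Del x (suc (rank i)) (i , x i)
  Del-rank i = refl , refl

  Del-unique : ∀ {k} {p q : Point d} → Del x k p → Del x k q → p ≡ q
  Del-unique {p = i , _} {j , _} (refl , eᵢ) (refl , eⱼ)
    with refl ← rank-injective (suc-injective (trans eᵢ (sym eⱼ))) = refl

  rankFin : Fin d → Fin d
  rankFin i = fromℕ< (rank<d i)

  rankFin-injective : Injective _≡_ _≡_ rankFin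
  rankFin-injective eq = rank-injective (fromℕ<-injective _ _ (rank<d _) (rank<d _) eq)

  Del-exists : ∀ k → 1 ≤ k → k ≤ d → ∃ (Del x k)
  Del-exists (suc k) _ k<d
    with i , rankFinᵢ≡k ← injective⇒surjective rankFin-injective (fromℕ< k<d) =
    (i , x i) , refl , cong suc (begin
      rank i               ≡⟨ toℕ-fromℕ< (rank<d i) ⟨
      toℕ (rankFin i)      ≡⟨ cong toℕ rankFinᵢ≡k ⟩
      toℕ (fromℕ< k<d)     ≡⟨ toℕ-fromℕ< k<d ⟩
      k                    ∎)
    where open ≡-Reasoning

  Del-mono-< : ∀ {k l} {p q : Point d} → Del x k p → Del x l q → k < l → p ≺ q
  Del-mono-< {p = p@(_ , _)} {q@(_ , _)} (refl , refl) (refl , refl) k<l =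
    ≰⇒> λ q≼p → <⇒≱ k<l (s≤s (countBelow-mono {q} {p} q≼p))

  Del-mono-≤ : ∀ {k l} {p q : Point d} → Del x k p → Del x l q → k ≤ l → key p ≤ key q
  Del-mono-≤ δp δq k≤l with m≤n⇒m<n∨m≡n k≤l
  ... | inj₁ k<l  = <⇒≤ (Del-mono-< δp δq k<l)
  ... | inj₂ refl = ≤-reflexive (cong key (Del-unique δp δq))

  Del⇒InSeats : ∀ {j k} {p : Point d} → Del x k p → j ≤ k → InSeats x j (seat p)
  Del⇒InSeats {p = _ , _} (refl , refl) j≤k = j≤k

open Ranks

module _ {d j : ℕ} {x x' : X d} (isG : IsG j x x') where

  IsG⇒NextIn : ∀ {k} {p p' : Point d} → 1 ≤ k → k ≤ d → j ≤ k → Del x k p → Del x' k p' →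
              NextIn (InSeats x j) p p'
  IsG⇒NextIn {p = p} 1≤k k≤d j≤k δp δp'
    with q , p→q , δq ← proj₂ (isG _ p 1≤k k≤d δp) j≤k
    = subst (NextIn (InSeats x j) p) (Del-unique x' δq δp') p→q

  IsG-no-seat-between : ∀ {r} {a a' b b' : Point d} → j ≤ r → Del x r b →
    NextIn (InSeats x r) a b → NextIn (InSeats x j) a a' → NextIn (InSeats x j) b b' →
    ∀ q → a' ≺ q → q ≺ b' → ¬ InSeats x' r (seat q)
  IsG-no-seat-between {r} {a} {a'} {b} {b'} j≤r δb (_ , _ , gapᵣ) (a≺a' , Sa' , _) b→b'
                      q a'≺q q≺b' r≤k
    with c , δc ← Del-exists x (suc (rank x' (seat q))) (s≤s z≤n) (rank<d x' (seat q))
    with c→r@(c≺r , Sr , _) ← IsG⇒NextIn (s≤s z≤n) (rank<d x' (seat q)) (≤-trans j≤r r≤k)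
                                         δc (Del-rank x' (seat q))
    with q≼b ← NextIn-gap {p = b} {b'} {q} b→b' Sr q≺b'
    with t , q↑t≡r ← ≺-same-seat⇒↑ {p = q} {seat q , x' (seat q)} refl
                       (≤-<-trans (≤-trans q≼b (Del-mono-≤ x {p = b} {c} δb δc r≤k)) c≺r)
    with q₀ , refl , a'≼q₀ , q₀≺q ← NextIn-lower {c = c} {a = a'} {q} {t} c→r q↑t≡r Sa' a'≺q
    = gapᵣ q₀ (<-≤-trans a≺a' a'≼q₀) (<-≤-trans q₀≺q q≼b) (Del⇒InSeats x δc r≤k)

lemma4p3 : (d : ℕ) → 2 ≤ d → (r : ℕ) → 2 ≤ r → r ≤ d → (j : ℕ) → 1 ≤ j → j < r →
    (x x' : X d) → IsG j x x' → Tight r x → Tight r x'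
lemma4p3 d _ (suc r₁) (s≤s 1≤r₁) r≤d j _ j<r x x' isG tight b' a' δb' δa'
  with a , δa ← Del-exists x r₁ 1≤r₁ (<⇒≤ r≤d)
  with b , δb ← Del-exists x (suc r₁) (s≤s z≤n) r≤d
  = Del-mono-< x' {p = a'} {b'} δa' δb' (n<1+n r₁)
  , Del⇒InSeats x' δb' ≤-refl
  , IsG-no-seat-between isG {a = a} {a'} {b} {b'} (<⇒≤ j<r) δb (tight b a δb δa)
      (IsG⇒NextIn isG 1≤r₁ (<⇒≤ r≤d) (s≤s⁻¹ j<r) δa δa')
      (IsG⇒NextIn isG (s≤s z≤n) r≤d (<⇒≤ j<r) δb δb')
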